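{- Let $F$ be an uncollapsible mixed graph. Then $\theta(F)=1$.
   Context: Mixed graphs: finite vertex set, at most one edge on each pair of distinct vertices, each edge undirected or directed from a tail to a head. A head (tail) vertex is one that is the head (tail) of some directed edge. $F$ is uncollapsible if some two head vertices are adjacent or some two tail vertices are adjacent. $\alpha(G),\beta(G)$ are the numbers of undirected and directed edges divided by $\binom{v(G)}2$. $F\subseteq G$ means there is an injection $\phi:V(F)\to V(G)$ sending undirected edges of $F$ to pairs joined by an edge of either type and each directed edge $u\to v$ of $F$ to the directed edge $\phi(u)\to\phi(v)$ of $G$. $\theta(F)$ is the maximum $\rho$ with $\limsup_n\max\{\alpha(G)+\rho\beta(G):G\ F\text{ -free},\ v(G)=n\}\le1$ ($\theta(F)=\infty$ if $\max\beta(G)\to0$).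
   Formalization: The coefficient ρ in the definition of θ(F), and the error tolerance in the limsup bound, range over the rationals. -}

module Defs where

open import Data.Nat as ℕ using (ℕ; zero; suc)
open import Data.Nat.Combinatorics using (_C_)
open import Data.Fin using (Fin; toℕ)
open import Data.Fin.Properties using ()
open import Data.Bool using (Bool; true; false; if_then_else_)
open import Data.List using (List; map; allFin)
open import Data.Nat.ListAction using (sum)
open import Data.Sum using (_⊎_)
open import Data.Integer using (+_)
open import Data.Rational using (ℚ; _/_; _+_; _*_; _≤_; _<_; 0ℚ; 1ℚ)
open import Data.Product using (Σ; ∃; ∃-syntax; _×_)
open import Relation.Binary.PropositionalEquality using (_≡_; _≢_)
open import Relation.Nullary using (¬_)
open import Relation.Nullary.Decidable using (⌊_⌋)
open import Function.Definitions using (Injective)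

-- The state of an ordered pair (i , j) of vertices:
--   none : not adjacent;  und : undirected edge;
--   fwd  : directed edge i → j;  bwd : directed edge j → i.
data Kind : Set where
  none und fwd bwd : Kind

flipK : Kind → Kind
flipK none = none
flipK und  = und
flipK fwd  = bwd
flipK bwd  = fwd

-- A mixed graph on vertex set Fin n: at most one edge per pair of
-- distinct vertices (encoded by a single Kind per ordered pair), no loops,
-- and the two orientations of a pair are consistent.
record MixedGraph (n : ℕ) : Set where
  field
    adj      : Fin n → Fin n → Kind
    loopless : ∀ i → adj i i ≡ none
    consist  : ∀ i j → adj j i ≡ flipK (adj i j)
open MixedGraph public

Adjacent : ∀ {n} → MixedGraph n → Fin n → Fin n → Set
Adjacent G u v = adj G u v ≢ none

IsHead : ∀ {n} → MixedGraph n → Fin n → Set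
IsHead G v = ∃[ w ] adj G w v ≡ fwd

IsTail : ∀ {n} → MixedGraph n → Fin n → Set
IsTail G v = ∃[ w ] adj G v w ≡ fwd

Uncollapsible : ∀ {k} → MixedGraph k → Set
Uncollapsible F =
  (∃[ u ] ∃[ v ] IsHead F u × IsHead F v × Adjacent F u v)
  ⊎ (∃[ u ] ∃[ v ] IsTail F u × IsTail F v × Adjacent F u v)

_⊆ᴹ_ : ∀ {k n} → MixedGraph k → MixedGraph n → Set
_⊆ᴹ_ {k} {n} F G =
  Σ (Fin k → Fin n) λ φ → Injective _≡_ _≡_ φ ×
    (∀ u v → adj F u v ≡ und → adj G (φ u) (φ v) ≢ none) ×
    (∀ u v → adj F u v ≡ fwd → adj G (φ u) (φ v) ≡ fwd)

Free : ∀ {k n} → MixedGraph k → MixedGraph n → Set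
Free F G = ¬ (F ⊆ᴹ G)

isUnd : Kind → Bool
isUnd und = true
isUnd _   = false

isFwd : Kind → Bool
isFwd fwd = true
isFwd _   = false

b2n : Bool → ℕ
b2n true  = 1
b2n false = 0

countPairs : ∀ {n} → (Fin n → Fin n → Bool) → ℕ
countPairs {n} P = sum (map (λ i → sum (map (λ j → b2n (P i j)) (allFin n))) (allFin n))

undEdges : ∀ {n} → MixedGraph n → ℕ
undEdges G = countPairs (λ i j → if ⌊ toℕ i ℕ.<? toℕ j ⌋ then isUnd (adj G i j) else false)

dirEdges : ∀ {n} → MixedGraph n → ℕ
dirEdges G = countPairs (λ i j → isFwd (adj G i j))

toℚ : ℕ → ℚ
toℚ n = + n / 1

-- α(G) + ρ β(G) ≤ c, written with the denominator C(n,2) cleared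
-- (only used for n ≥ 2, where C(n,2) > 0).
WeightAtMost : ∀ {n} → ℚ → MixedGraph n → ℚ → Set
WeightAtMost {n} ρ G c = toℚ (undEdges G) + ρ * toℚ (dirEdges G) ≤ c * toℚ (n C 2)

-- limsup_n max { α(G) + ρ β(G) : G F-free, v(G) = n } ≤ 1
Admissible : ∀ {k} → MixedGraph k → ℚ → Set
Admissible F ρ =
  ∀ (ε : ℚ) → 0ℚ < ε → ∃[ N ] ∀ (n : ℕ) → N ℕ.≤ n → 2 ℕ.≤ n →
    ∀ (G : MixedGraph n) → Free F G → WeightAtMost ρ G (1ℚ + ε)

-- θ(F) = 1 : ρ = 1 is admissible and no ρ > 1 is admissible
-- (the admissible set is downward closed, so this says the maximum is 1;
-- in particular θ(F) ≠ ∞).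
ThetaIsOne : ∀ {k} → MixedGraph k → Set
ThetaIsOne F = Admissible F 1ℚ × (∀ (ρ : ℚ) → 1ℚ < ρ → ¬ Admissible F ρ)

-- Every mixed graph has at most C(n,2) edges, so α + β ≤ 1 and ρ = 1 is admissible.  For ρ > 1
-- take the split graph: a clique on m vertices, a stable set on h vertices, and all m h edges
-- between them directed from the clique to the stable set (or all reversed).  Its heads (tails)
-- form a stable set, so it contains no F with two adjacent heads (tails); with m = (d+1)h and
-- ρ ≥ 1 + 1/d its weight α + ρβ exceeds 1 + 1/(d+1)² for every h.
module Submission where

open import Defs
open import Data.Bool using (Bool; true; false; if_then_else_)
open import Data.Empty using (⊥-elim)
open import Data.Fin using (Fin; toℕ; splitAt; _↑ˡ_; _↑ʳ_; _≟_) renaming (zero to fzero; suc to fsuc)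
open import Data.Fin.Properties using (toℕ-injective; toℕ-↑ˡ; splitAt-↑ˡ; splitAt-↑ʳ)
open import Data.Integer as ℤ using (-[1+_]; +≤+; +<+)
import Data.Integer.Properties as ℤ
open import Data.List using (map; allFin; tabulate)
open import Data.List.Properties using (map-tabulate)
open import Data.Nat using (ℕ; zero; suc; _+_; _*_; _≤_; _<_; z≤n; s≤s; _<?_)
open import Data.Nat.Combinatorics using (_C_; nC1≡n; nCk+nC[k+1]≡[n+1]C[k+1])
open import Data.Nat.Coprimality using (1-coprimeTo)
import Data.Nat.ListAction as List
open import Data.Nat.Properties
  using ( +-0-commutativeMonoid; +-assoc; +-identityʳ; *-identityʳ; ≤-refl; ≤-reflexive; ≤-trans
        ; ≤-antisym; ≮⇒≥; <-irrefl; <⇒≱; n≤1+n; m≤m+n; m≤n+m; m<m+n; +-mono-≤; +-monoʳ-≤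
        ; *-monoˡ-≤; +-cancelʳ-<; *-cancelˡ-<; module ≤-Reasoning)
open import Data.Nat.Tactic.RingSolver using (solve-∀)
open import Data.Product using (Σ-syntax; ∃-syntax; _×_; _,_; proj₁; proj₂)
open import Data.Rational as ℚ using (ℚ; mkℚ; 0ℚ; 1ℚ; toℚᵘ; NonNegative; nonNegative; *<*)
import Data.Rational.Properties as ℚ
open import Data.Rational.Solver using (module +-*-Solver)
open import Data.Rational.Unnormalised as ℚᵘ using (ℚᵘ; mkℚᵘ; *≡*; *≤*)
  renaming (_≃_ to _≃ᵘ_; _≤_ to _≤ᵘ_)
import Data.Rational.Unnormalised.Properties as ℚᵘ
open import Data.Sum using (_⊎_; inj₁; inj₂)
open import Function using (id; _∘_; case_of_)
open import Relation.Binary.PropositionalEquality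
open import Relation.Nullary using (¬_; does; yes; no)
open import Relation.Nullary.Decidable using (⌊_⌋; isYes≗does)

open import Algebra.Properties.CommutativeMonoid.Sum +-0-commutativeMonoid
  using (sum-syntax; sum-cong-≗; ∑-distrib-+; ∑-comm)

-- Finite sums

sum-map-allFin : ∀ n (f : Fin n → ℕ) → List.sum (map f (allFin n)) ≡ ∑[ i < n ] f i
sum-map-allFin n f = trans (cong List.sum (map-tabulate id f)) (sum-tabulate n f)
  where
  sum-tabulate : ∀ n (f : Fin n → ℕ) → List.sum (tabulate f) ≡ ∑[ i < n ] f i
  sum-tabulate zero    f = refl
  sum-tabulate (suc n) f = cong (f fzero +_) (sum-tabulate n (f ∘ fsuc))

countPairs≡∑∑ : ∀ {n} (P : Fin n → Fin n → Bool) → countPairs P ≡ ∑[ i < n ] ∑[ j < n ] b2n (P i j)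
countPairs≡∑∑ {n} P = trans (sum-map-allFin n _) (sum-cong-≗ (λ i → sum-map-allFin n (b2n ∘ P i)))

∑-mono-≤ : ∀ n {f g : Fin n → ℕ} → (∀ i → f i ≤ g i) → ∑[ i < n ] f i ≤ ∑[ i < n ] g i
∑-mono-≤ zero    f≤g = z≤n
∑-mono-≤ (suc n) f≤g = +-mono-≤ (f≤g fzero) (∑-mono-≤ n (f≤g ∘ fsuc))

∑-const : ∀ n c → ∑[ i < n ] c ≡ n * c
∑-const zero    c = refl
∑-const (suc n) c = cong (c +_) (∑-const n c)

∑-zero : ∀ n {f : Fin n → ℕ} → (∀ i → f i ≡ 0) → ∑[ i < n ] f i ≡ 0
∑-zero zero    f≗0 = refl
∑-zero (suc n) f≗0 = cong₂ _+_ (f≗0 fzero) (∑-zero n (f≗0 ∘ fsuc))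

∑-↑ : ∀ m h (f : Fin (m + h) → ℕ) → ∑[ i < m + h ] f i ≡ ∑[ i < m ] f (i ↑ˡ h) + ∑[ j < h ] f (m ↑ʳ j)
∑-↑ zero    h f = refl
∑-↑ (suc m) h f = trans (cong (f fzero +_) (∑-↑ m h (f ∘ fsuc))) (sym (+-assoc (f fzero) _ _))

∑∑-cong : ∀ n {f g : Fin n → Fin n → ℕ} → (∀ i j → f i j ≡ g i j) →
  ∑[ i < n ] ∑[ j < n ] f i j ≡ ∑[ i < n ] ∑[ j < n ] g i j
∑∑-cong n f≗g = sum-cong-≗ {n} (λ i → sum-cong-≗ {n} (f≗g i))

∑∑-mono-≤ : ∀ n {f g : Fin n → Fin n → ℕ} → (∀ i j → f i j ≤ g i j) →
  ∑[ i < n ] ∑[ j < n ] f i j ≤ ∑[ i < n ] ∑[ j < n ] g i j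
∑∑-mono-≤ n f≤g = ∑-mono-≤ n (λ i → ∑-mono-≤ n (f≤g i))

∑∑-distrib-+ : ∀ n (f g : Fin n → Fin n → ℕ) →
  ∑[ i < n ] ∑[ j < n ] (f i j + g i j) ≡ ∑[ i < n ] ∑[ j < n ] f i j + ∑[ i < n ] ∑[ j < n ] g i j
∑∑-distrib-+ n f g = trans (sum-cong-≗ (λ i → ∑-distrib-+ (f i) (g i)))
                           (∑-distrib-+ {n} (λ i → ∑[ j < n ] f i j) (λ i → ∑[ j < n ] g i j))

-- Counting edges

[1+n]C2≡n+nC2 : ∀ n → suc n C 2 ≡ n + n C 2
[1+n]C2≡n+nC2 n = trans (sym (nCk+nC[k+1]≡[n+1]C[k+1] n 1)) (cong (_+ n C 2) (nC1≡n n))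

2*nC2+n≡n*n : ∀ n → 2 * (n C 2) + n ≡ n * n
2*nC2+n≡n*n zero    = refl
2*nC2+n≡n*n (suc n) = begin
  2 * (suc n C 2) + suc n         ≡⟨ cong (λ c → 2 * c + suc n) ([1+n]C2≡n+nC2 n) ⟩
  2 * (n + n C 2) + suc n         ≡⟨ regroup n (n C 2) ⟩
  (2 * (n C 2) + n) + suc (2 * n) ≡⟨ cong (_+ suc (2 * n)) (2*nC2+n≡n*n n) ⟩
  n * n + suc (2 * n)             ≡⟨ square-suc n ⟩
  suc n * suc n                   ∎
  where
  open ≡-Reasoning
  regroup : ∀ n c → 2 * (n + c) + suc n ≡ (2 * c + n) + suc (2 * n)
  regroup = solve-∀
  square-suc : ∀ n → n * n + suc (2 * n) ≡ suc n * suc n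
  square-suc = solve-∀

∑∑[i<j]≡nC2 : ∀ n → ∑[ i < n ] ∑[ j < n ] b2n ⌊ toℕ i <? toℕ j ⌋ ≡ n C 2
∑∑[i<j]≡nC2 n = trans (∑∑-cong n λ i j → cong b2n (isYes≗does (toℕ i <? toℕ j))) (count n)
  where
  -- Unlike ⌊_⌋, does (suc a <? suc b) reduces to does (a <? b), so each step is definitional.
  count : ∀ n → ∑[ i < n ] ∑[ j < n ] b2n (does (toℕ i <? toℕ j)) ≡ n C 2
  count zero    = refl
  count (suc n) = trans (cong₂ _+_ (trans (∑-const n 1) (*-identityʳ n)) (count n))
                        (sym ([1+n]C2≡n+nC2 n))

pair-weight-≤ : ∀ b k →
  b2n (if b then isUnd k else false)
    + (b2n (if b then isFwd k else false) + b2n (if b then isFwd (flipK k) else false)) ≤ b2n b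
pair-weight-≤ false k    = z≤n
pair-weight-≤ true  none = z≤n
pair-weight-≤ true  und  = ≤-refl
pair-weight-≤ true  fwd  = ≤-refl
pair-weight-≤ true  bwd  = ≤-refl

module _ {n} (G : MixedGraph n) where

  private
    _≺_ : Fin n → Fin n → Bool
    i ≺ j = ⌊ toℕ i <? toℕ j ⌋

  fwd-off-diagonal : ∀ i j → b2n (isFwd (adj G i j)) ≤
    b2n (if i ≺ j then isFwd (adj G i j) else false) + b2n (if j ≺ i then isFwd (adj G i j) else false)
  fwd-off-diagonal i j with toℕ i <? toℕ j | toℕ j <? toℕ i
  ... | yes _  | _      = m≤m+n _ _
  ... | no _   | yes _  = m≤n+m _ _
  ... | no i≮j | no j≮i rewrite toℕ-injective (≤-antisym (≮⇒≥ j≮i) (≮⇒≥ i≮j)) | loopless G j = z≤n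

  -- Split the directed edges i → j by i < j or j < i and swap the second double sum: then each
  -- pair i < j carries at most one of und, fwd and bwd.
  undEdges+dirEdges≤nC2 : undEdges G + dirEdges G ≤ n C 2
  undEdges+dirEdges≤nC2 = begin
    undEdges G + dirEdges G
      ≡⟨ cong₂ _+_ (countPairs≡∑∑ (λ i j → if i ≺ j then isUnd (adj G i j) else false))
                   (countPairs≡∑∑ (λ i j → isFwd (adj G i j))) ⟩
    ∑∑ U + ∑∑ F
      ≤⟨ +-monoʳ-≤ (∑∑ U) (≤-trans (∑∑-mono-≤ n fwd-off-diagonal) (≤-reflexive (∑∑-distrib-+ n A B))) ⟩
    ∑∑ U + (∑∑ A + ∑∑ B)
      ≡⟨ cong (λ x → ∑∑ U + (∑∑ A + x)) (∑-comm B) ⟩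
    ∑∑ U + (∑∑ A + ∑∑ (λ i j → B j i))
      ≡⟨ cong (λ x → ∑∑ U + (∑∑ A + x))
              (∑∑-cong n λ i j → cong (λ k → b2n (if i ≺ j then isFwd k else false)) (consist G i j)) ⟩
    ∑∑ U + (∑∑ A + ∑∑ B′)
      ≡⟨ trans (∑∑-distrib-+ n U _) (cong (∑∑ U +_) (∑∑-distrib-+ n A B′)) ⟨
    ∑∑ (λ i j → U i j + (A i j + B′ i j))
      ≤⟨ ∑∑-mono-≤ n (λ i j → pair-weight-≤ (i ≺ j) (adj G i j)) ⟩
    ∑∑ (λ i j → b2n (i ≺ j))
      ≡⟨ ∑∑[i<j]≡nC2 n ⟩
    n C 2 ∎
    where
    open ≤-Reasoning
    ∑∑ : (Fin n → Fin n → ℕ) → ℕ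
    ∑∑ f = ∑[ i < n ] ∑[ j < n ] f i j
    U F A B B′ : Fin n → Fin n → ℕ
    U i j  = b2n (if i ≺ j then isUnd (adj G i j) else false)
    F i j  = b2n (isFwd (adj G i j))
    A i j  = b2n (if i ≺ j then isFwd (adj G i j) else false)
    B i j  = b2n (if j ≺ i then isFwd (adj G i j) else false)
    B′ i j = b2n (if i ≺ j then isFwd (flipK (adj G i j)) else false)

-- Embeddings and reversal

HeadsNonadjacent : ∀ {n} → MixedGraph n → Set
HeadsNonadjacent G = ∀ x y → IsHead G x → IsHead G y → ¬ Adjacent G x y

AdjacentHeads : ∀ {k} → MixedGraph k → Set
AdjacentHeads F = ∃[ u ] ∃[ v ] IsHead F u × IsHead F v × Adjacent F u v

⊆-head : ∀ {k n} {F : MixedGraph k} {G : MixedGraph n} (F⊆G : F ⊆ᴹ G) {u} →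
  IsHead F u → IsHead G (proj₁ F⊆G u)
⊆-head (φ , _ , _ , fwd⇒fwd) (w , w→u) = φ w , fwd⇒fwd w _ w→u

⊆-adjacent : ∀ {k n} {F : MixedGraph k} {G : MixedGraph n} (F⊆G : F ⊆ᴹ G) {u v} →
  Adjacent F u v → Adjacent G (proj₁ F⊆G u) (proj₁ F⊆G v)
⊆-adjacent {F = F} {G} (φ , _ , und⇒edge , fwd⇒fwd) {u} {v} u~v with adj F u v in uv
... | none = ⊥-elim (u~v refl)
... | und  = und⇒edge u v uv
... | fwd  = λ φuv≡none → case trans (sym φuv≡none) (fwd⇒fwd u v uv) of λ ()
... | bwd  = λ φuv≡none → case trans (sym φuv≡none) φv→φu of λ ()
  where
  φv→φu : adj G (φ u) (φ v) ≡ bwd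
  φv→φu = trans (consist G (φ v) (φ u)) (cong flipK (fwd⇒fwd v u (trans (consist F u v) (cong flipK uv))))

heads-nonadjacent⇒free : ∀ {k n} {F : MixedGraph k} {G : MixedGraph n} →
  HeadsNonadjacent G → AdjacentHeads F → Free F G
heads-nonadjacent⇒free {F = F} {G} nonadjacent (u , v , head-u , head-v , u~v) F⊆G =
  nonadjacent _ _ (⊆-head {F = F} {G} F⊆G head-u) (⊆-head {F = F} {G} F⊆G head-v)
                  (⊆-adjacent {F = F} {G} F⊆G u~v)

-- Tails of G are exactly the heads of reverse G.
reverse : ∀ {n} → MixedGraph n → MixedGraph n
reverse G = record
  { adj      = λ i j → adj G j i
  ; loopless = loopless G
  ; consist  = λ i j → consist G j i
  }

⊆-reverse : ∀ {k n} {F : MixedGraph k} {G : MixedGraph n} → F ⊆ᴹ G → reverse F ⊆ᴹ reverse G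
⊆-reverse (φ , φ-injective , und⇒edge , fwd⇒fwd) =
  φ , φ-injective , (λ u v → und⇒edge v u) , (λ u v → fwd⇒fwd v u)

isUnd-flipK : ∀ k → isUnd (flipK k) ≡ isUnd k
isUnd-flipK none = refl
isUnd-flipK und  = refl
isUnd-flipK fwd  = refl
isUnd-flipK bwd  = refl

module _ {n} (G : MixedGraph n) where

  private
    _≺_ : Fin n → Fin n → Bool
    i ≺ j = ⌊ toℕ i <? toℕ j ⌋

  undEdges-reverse : undEdges (reverse G) ≡ undEdges G
  undEdges-reverse = begin
    undEdges (reverse G)  ≡⟨ countPairs≡∑∑ (λ i j → if i ≺ j then isUnd (adj G j i) else false) ⟩
    ∑[ i < n ] ∑[ j < n ] b2n (if i ≺ j then isUnd (adj G j i) else false)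
      ≡⟨ ∑∑-cong n (λ i j → cong (λ b → b2n (if i ≺ j then b else false))
                                 (trans (cong isUnd (consist G i j)) (isUnd-flipK (adj G i j)))) ⟩
    ∑[ i < n ] ∑[ j < n ] b2n (if i ≺ j then isUnd (adj G i j) else false)
      ≡⟨ countPairs≡∑∑ (λ i j → if i ≺ j then isUnd (adj G i j) else false) ⟨
    undEdges G            ∎
    where open ≡-Reasoning

  dirEdges-reverse : dirEdges (reverse G) ≡ dirEdges G
  dirEdges-reverse = begin
    dirEdges (reverse G)                          ≡⟨ countPairs≡∑∑ (λ i j → isFwd (adj G j i)) ⟩
    ∑[ i < n ] ∑[ j < n ] b2n (isFwd (adj G j i)) ≡⟨ ∑-comm (λ i j → b2n (isFwd (adj G j i))) ⟩
    ∑[ i < n ] ∑[ j < n ] b2n (isFwd (adj G i j)) ≡⟨ countPairs≡∑∑ (λ i j → isFwd (adj G i j)) ⟨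
    dirEdges G                                    ∎
    where open ≡-Reasoning

-- The split graph

cliqueKind : ∀ {m} → Fin m → Fin m → Kind
cliqueKind i j = if ⌊ i ≟ j ⌋ then none else und

cliqueKind-diag : ∀ {m} (i : Fin m) → cliqueKind i i ≡ none
cliqueKind-diag i with i ≟ i
... | yes _  = refl
... | no i≢i = ⊥-elim (i≢i refl)

cliqueKind-sym : ∀ {m} (i j : Fin m) → cliqueKind j i ≡ flipK (cliqueKind i j)
cliqueKind-sym i j with i ≟ j | j ≟ i
... | yes _   | yes _   = refl
... | no _    | no _    = refl
... | yes i≡j | no j≢i  = ⊥-elim (j≢i (sym i≡j))
... | no i≢j  | yes j≡i = ⊥-elim (i≢j (sym j≡i))

isFwd-cliqueKind : ∀ {m} (i j : Fin m) → isFwd (cliqueKind i j) ≡ false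
isFwd-cliqueKind i j with i ≟ j
... | yes _ = refl
... | no _  = refl

isUnd-cliqueKind : ∀ {m} (i j : Fin m) → toℕ i < toℕ j → isUnd (cliqueKind i j) ≡ true
isUnd-cliqueKind i j i<j with i ≟ j
... | yes refl = ⊥-elim (<-irrefl refl i<j)
... | no _     = refl

splitKind : ∀ {m h} → Fin m ⊎ Fin h → Fin m ⊎ Fin h → Kind
splitKind (inj₁ i) (inj₁ j) = cliqueKind i j
splitKind (inj₁ _) (inj₂ _) = fwd
splitKind (inj₂ _) (inj₁ _) = bwd
splitKind (inj₂ _) (inj₂ _) = none

splitKind-diag : ∀ {m h} (x : Fin m ⊎ Fin h) → splitKind x x ≡ none
splitKind-diag (inj₁ i) = cliqueKind-diag i
splitKind-diag (inj₂ _) = refl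

splitKind-sym : ∀ {m h} (x y : Fin m ⊎ Fin h) → splitKind y x ≡ flipK (splitKind x y)
splitKind-sym (inj₁ i) (inj₁ j) = cliqueKind-sym i j
splitKind-sym (inj₁ _) (inj₂ _) = refl
splitKind-sym (inj₂ _) (inj₁ _) = refl
splitKind-sym (inj₂ _) (inj₂ _) = refl

splitKind-fwd⇒stable : ∀ {m h} (w x : Fin m ⊎ Fin h) → splitKind w x ≡ fwd → ∃[ j ] x ≡ inj₂ j
splitKind-fwd⇒stable (inj₁ i) (inj₁ j) i→j = case trans (sym (cong isFwd i→j)) (isFwd-cliqueKind i j) of λ ()
splitKind-fwd⇒stable (inj₁ _) (inj₂ j) _   = j , refl

splitKind-from-stable : ∀ {m h} (j : Fin h) (y : Fin m ⊎ Fin h) →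
  isUnd (splitKind (inj₂ j) y) ≡ false × isFwd (splitKind (inj₂ j) y) ≡ false
splitKind-from-stable j (inj₁ _) = refl , refl
splitKind-from-stable j (inj₂ _) = refl , refl

splitGraph : ∀ m h → MixedGraph (m + h)
splitGraph m h = record
  { adj      = λ i j → splitKind (splitAt m i) (splitAt m j)
  ; loopless = λ i → splitKind-diag (splitAt m i)
  ; consist  = λ i j → splitKind-sym (splitAt m i) (splitAt m j)
  }

module _ (m h : ℕ) where

  private
    G = splitGraph m h

  splitGraph-heads-nonadjacent : HeadsNonadjacent G
  splitGraph-heads-nonadjacent x y (w , w→x) (w′ , w′→y) x~y
    with splitKind-fwd⇒stable (splitAt m w) (splitAt m x) w→x
       | splitKind-fwd⇒stable (splitAt m w′) (splitAt m y) w′→y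
  ... | _ , x∈stable | _ , y∈stable = x~y (cong₂ splitKind x∈stable y∈stable)

  adj-↑ˡ-↑ˡ : ∀ i j → adj G (i ↑ˡ h) (j ↑ˡ h) ≡ cliqueKind i j
  adj-↑ˡ-↑ˡ i j = cong₂ splitKind (splitAt-↑ˡ m i h) (splitAt-↑ˡ m j h)

  adj-↑ˡ-↑ʳ : ∀ i j → adj G (i ↑ˡ h) (m ↑ʳ j) ≡ fwd
  adj-↑ˡ-↑ʳ i j = cong₂ splitKind (splitAt-↑ˡ m i h) (splitAt-↑ʳ m h j)

  adj-↑ʳ : ∀ j y → adj G (m ↑ʳ j) y ≡ splitKind (inj₂ j) (splitAt m y)
  adj-↑ʳ j y = cong (λ x → splitKind x (splitAt m y)) (splitAt-↑ʳ m h j)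

  undEdges-splitGraph : undEdges G ≡ m C 2
  undEdges-splitGraph = begin
    undEdges G
      ≡⟨ countPairs≡∑∑ (λ x y → if x ≺ y then isUnd (adj G x y) else false) ⟩
    ∑[ x < m + h ] ∑[ y < m + h ] U x y
      ≡⟨ ∑-↑ m h _ ⟩
    ∑[ i < m ] ∑[ y < m + h ] U (i ↑ˡ h) y + ∑[ j < h ] ∑[ y < m + h ] U (m ↑ʳ j) y
      ≡⟨ cong₂ _+_ (sum-cong-≗ {m} λ i → trans (∑-↑ m h _)
                                              (cong₂ _+_ (sum-cong-≗ {m} (clique i)) (∑-zero h (cross i))))
                   (∑-zero h (λ j → ∑-zero (m + h) (stable j))) ⟩
    ∑[ i < m ] (∑[ j < m ] b2n ⌊ toℕ i <? toℕ j ⌋ + 0) + 0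
      ≡⟨ trans (+-identityʳ _) (sum-cong-≗ {m} λ i → +-identityʳ _) ⟩
    ∑[ i < m ] ∑[ j < m ] b2n ⌊ toℕ i <? toℕ j ⌋
      ≡⟨ ∑∑[i<j]≡nC2 m ⟩
    m C 2 ∎
    where
    open ≡-Reasoning
    _≺_ : Fin (m + h) → Fin (m + h) → Bool
    x ≺ y = ⌊ toℕ x <? toℕ y ⌋
    U : Fin (m + h) → Fin (m + h) → ℕ
    U x y = b2n (if x ≺ y then isUnd (adj G x y) else false)
    b2n-if-false : ∀ c → b2n (if c then false else false) ≡ 0
    b2n-if-false false = refl
    b2n-if-false true  = refl
    clique : ∀ i j → U (i ↑ˡ h) (j ↑ˡ h) ≡ b2n ⌊ toℕ i <? toℕ j ⌋
    clique i j rewrite adj-↑ˡ-↑ˡ i j | toℕ-↑ˡ i h | toℕ-↑ˡ j h with toℕ i <? toℕ j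
    ... | yes i<j = cong b2n (isUnd-cliqueKind i j i<j)
    ... | no _    = refl
    cross : ∀ i j → U (i ↑ˡ h) (m ↑ʳ j) ≡ 0
    cross i j rewrite adj-↑ˡ-↑ʳ i j = b2n-if-false ((i ↑ˡ h) ≺ (m ↑ʳ j))
    stable : ∀ j y → U (m ↑ʳ j) y ≡ 0
    stable j y rewrite adj-↑ʳ j y | proj₁ (splitKind-from-stable j (splitAt m y)) = b2n-if-false ((m ↑ʳ j) ≺ y)

  dirEdges-splitGraph : dirEdges G ≡ m * h
  dirEdges-splitGraph = begin
    dirEdges G
      ≡⟨ countPairs≡∑∑ (λ x y → isFwd (adj G x y)) ⟩
    ∑[ x < m + h ] ∑[ y < m + h ] D x y
      ≡⟨ ∑-↑ m h _ ⟩
    ∑[ i < m ] ∑[ y < m + h ] D (i ↑ˡ h) y + ∑[ j < h ] ∑[ y < m + h ] D (m ↑ʳ j) y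
      ≡⟨ cong₂ _+_ (sum-cong-≗ {m} λ i → trans (∑-↑ m h _)
                                              (cong₂ _+_ (∑-zero m (clique i)) (sum-cong-≗ {h} (cross i))))
                   (∑-zero h (λ j → ∑-zero (m + h) (stable j))) ⟩
    ∑[ i < m ] (0 + ∑[ j < h ] 1) + 0
      ≡⟨ trans (+-identityʳ _) (trans (∑-const m _) (cong (m *_) (trans (∑-const h 1) (*-identityʳ h)))) ⟩
    m * h ∎
    where
    open ≡-Reasoning
    D : Fin (m + h) → Fin (m + h) → ℕ
    D x y = b2n (isFwd (adj G x y))
    clique : ∀ i j → D (i ↑ˡ h) (j ↑ˡ h) ≡ 0
    clique i j = cong b2n (trans (cong isFwd (adj-↑ˡ-↑ˡ i j)) (isFwd-cliqueKind i j))
    cross : ∀ i j → D (i ↑ˡ h) (m ↑ʳ j) ≡ 1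
    cross i j = cong (b2n ∘ isFwd) (adj-↑ˡ-↑ʳ i j)
    stable : ∀ j y → D (m ↑ʳ j) y ≡ 0
    stable j y = cong b2n (trans (cong isFwd (adj-↑ʳ j y)) (proj₂ (splitKind-from-stable j (splitAt m y))))

free-split-graph : ∀ {k} (F : MixedGraph k) → Uncollapsible F → ∀ m h →
  Σ[ G ∈ MixedGraph (m + h) ] Free F G × undEdges G ≡ m C 2 × dirEdges G ≡ m * h
free-split-graph F (inj₁ adjacent-heads) m h =
  splitGraph m h ,
  heads-nonadjacent⇒free {F = F} {splitGraph m h} (splitGraph-heads-nonadjacent m h) adjacent-heads ,
  undEdges-splitGraph m h ,
  dirEdges-splitGraph m h
free-split-graph F (inj₂ (u , v , tail-u , tail-v , u~v)) m h =
  reverse (splitGraph m h) ,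
  (λ F⊆G → heads-nonadjacent⇒free {F = reverse F} {splitGraph m h} (splitGraph-heads-nonadjacent m h)
             (v , u , tail-v , tail-u , u~v) (⊆-reverse {F = F} {reverse (splitGraph m h)} F⊆G)) ,
  trans (undEdges-reverse (splitGraph m h)) (undEdges-splitGraph m h) ,
  trans (dirEdges-reverse (splitGraph m h)) (dirEdges-splitGraph m h)

-- Clearing denominators

fromℕᵘ : ℕ → ℚᵘ
fromℕᵘ n = mkℚᵘ (ℤ.+ n) 0

toℚᵘ-toℚ : ∀ n → toℚᵘ (toℚ n) ≃ᵘ fromℕᵘ n
toℚᵘ-toℚ n = ℚ.toℚᵘ-fromℚᵘ (fromℕᵘ n)

fromℕᵘ-+ : ∀ m n → fromℕᵘ (m + n) ≃ᵘ fromℕᵘ m ℚᵘ.+ fromℕᵘ n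
fromℕᵘ-+ m n = *≡* (cong (ℤ._* ℤ.+ 1) (sym (cong₂ ℤ._+_ (ℤ.*-identityʳ (ℤ.+ m)) (ℤ.*-identityʳ (ℤ.+ n)))))

fromℕᵘ-* : ∀ m n → fromℕᵘ (m * n) ≃ᵘ fromℕᵘ m ℚᵘ.* fromℕᵘ n
fromℕᵘ-* m n = *≡* (cong (ℤ._* ℤ.+ 1) (ℤ.pos-* m n))

fromℕᵘ-mono-≤ : ∀ {m n} → m ≤ n → fromℕᵘ m ≤ᵘ fromℕᵘ n
fromℕᵘ-mono-≤ {m} {n} m≤n = *≤* (subst₂ ℤ._≤_ (sym (ℤ.*-identityʳ (ℤ.+ m))) (sym (ℤ.*-identityʳ (ℤ.+ n))) (+≤+ m≤n))

fromℕᵘ-cancel-≤ : ∀ {m n} → fromℕᵘ m ≤ᵘ fromℕᵘ n → m ≤ n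
fromℕᵘ-cancel-≤ {m} {n} (*≤* m≤n) = ℤ.drop‿+≤+ (subst₂ ℤ._≤_ (ℤ.*-identityʳ (ℤ.+ m)) (ℤ.*-identityʳ (ℤ.+ n)) m≤n)

toℚ-+ : ∀ m n → toℚ (m + n) ≡ toℚ m ℚ.+ toℚ n
toℚ-+ m n = ℚ.toℚᵘ-injective (begin
  toℚᵘ (toℚ (m + n))                ≈⟨ toℚᵘ-toℚ (m + n) ⟩
  fromℕᵘ (m + n)                    ≈⟨ fromℕᵘ-+ m n ⟩
  fromℕᵘ m ℚᵘ.+ fromℕᵘ n            ≈⟨ ℚᵘ.+-cong (toℚᵘ-toℚ m) (toℚᵘ-toℚ n) ⟨
  toℚᵘ (toℚ m) ℚᵘ.+ toℚᵘ (toℚ n)    ≈⟨ ℚ.toℚᵘ-homo-+ (toℚ m) (toℚ n) ⟨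
  toℚᵘ (toℚ m ℚ.+ toℚ n)            ∎)
  where open ℚᵘ.≃-Reasoning

toℚ-* : ∀ m n → toℚ (m * n) ≡ toℚ m ℚ.* toℚ n
toℚ-* m n = ℚ.toℚᵘ-injective (begin
  toℚᵘ (toℚ (m * n))                ≈⟨ toℚᵘ-toℚ (m * n) ⟩
  fromℕᵘ (m * n)                    ≈⟨ fromℕᵘ-* m n ⟩
  fromℕᵘ m ℚᵘ.* fromℕᵘ n            ≈⟨ ℚᵘ.*-cong (toℚᵘ-toℚ m) (toℚᵘ-toℚ n) ⟨
  toℚᵘ (toℚ m) ℚᵘ.* toℚᵘ (toℚ n)    ≈⟨ ℚ.toℚᵘ-homo-* (toℚ m) (toℚ n) ⟨
  toℚᵘ (toℚ m ℚ.* toℚ n)            ∎)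
  where open ℚᵘ.≃-Reasoning

toℚ-mono-≤ : ∀ {m n} → m ≤ n → toℚ m ℚ.≤ toℚ n
toℚ-mono-≤ {m} {n} m≤n = ℚ.toℚᵘ-cancel-≤
  (ℚᵘ.≤-respʳ-≃ (ℚᵘ.≃-sym (toℚᵘ-toℚ n)) (ℚᵘ.≤-respˡ-≃ (ℚᵘ.≃-sym (toℚᵘ-toℚ m)) (fromℕᵘ-mono-≤ m≤n)))

toℚ-cancel-≤ : ∀ {m n} → toℚ m ℚ.≤ toℚ n → m ≤ n
toℚ-cancel-≤ {m} {n} m≤n = fromℕᵘ-cancel-≤
  (ℚᵘ.≤-respʳ-≃ (toℚᵘ-toℚ n) (ℚᵘ.≤-respˡ-≃ (toℚᵘ-toℚ m) (ℚ.toℚᵘ-mono-≤ m≤n)))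

toℚ-nonNegative : ∀ n → NonNegative (toℚ n)
toℚ-nonNegative n = nonNegative {toℚ n} (toℚ-mono-≤ {0} {n} z≤n)

fraction-*-denominator : ∀ {p} r d-1 → toℚᵘ p ≃ᵘ mkℚᵘ (ℤ.+ r) d-1 → p ℚ.* toℚ (suc d-1) ≡ toℚ r
fraction-*-denominator {p} r d-1 p≃r/d = ℚ.toℚᵘ-injective (begin
  toℚᵘ (p ℚ.* toℚ (suc d-1))            ≈⟨ ℚ.toℚᵘ-homo-* p (toℚ (suc d-1)) ⟩
  toℚᵘ p ℚᵘ.* toℚᵘ (toℚ (suc d-1))      ≈⟨ ℚᵘ.*-cong p≃r/d (toℚᵘ-toℚ (suc d-1)) ⟩
  mkℚᵘ (ℤ.+ r) d-1 ℚᵘ.* fromℕᵘ (suc d-1) ≈⟨ *≡* (trans (ℤ.*-identityʳ _)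
                                              (cong (λ k → ℤ.+ r ℤ.* ℤ.+ k) (sym (*-identityʳ (suc d-1))))) ⟩
  fromℕᵘ r                              ≈⟨ toℚᵘ-toℚ r ⟨
  toℚᵘ (toℚ r)                          ∎)
  where open ℚᵘ.≃-Reasoning

1<p⇒fraction : ∀ {p} → 1ℚ ℚ.< p → ∃[ r ] ∃[ d ] d < r × p ℚ.* toℚ d ≡ toℚ r
1<p⇒fraction {mkℚ (ℤ.+ r) d-1 _} (*<* 1*d<r*1) =
  r , suc d-1 , ℤ.drop‿+<+ (subst₂ ℤ._<_ (ℤ.*-identityˡ _) (ℤ.*-identityʳ _) 1*d<r*1) ,
  fraction-*-denominator r d-1 ℚᵘ.≃-refl
1<p⇒fraction {mkℚ -[1+ _ ] _ _} (*<* ())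

1/[1+_] : ℕ → ℚ
1/[1+ n ] = mkℚ (ℤ.+ 1) n (1-coprimeTo (suc n))

1/[1+n]>0 : ∀ n → 0ℚ ℚ.< 1/[1+ n ]
1/[1+n]>0 n = *<* (+<+ (s≤s z≤n))

clear-denominators : ∀ {ρ ε : ℚ} U D C r d p e →
  ρ ℚ.* toℚ d ≡ toℚ r → ε ℚ.* toℚ e ≡ toℚ p →
  toℚ U ℚ.+ ρ ℚ.* toℚ D ℚ.≤ (1ℚ ℚ.+ ε) ℚ.* toℚ C →
  (U * d + r * D) * e ≤ (e + p) * C * d
clear-denominators {ρ} {ε} U D C r d p e ρd≡r εe≡p weight≤ = toℚ-cancel-≤ (begin
  toℚ ((U * d + r * D) * e)
    ≡⟨ trans (toℚ-* (U * d + r * D) e)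
             (cong (ℚ._* toℚ e) (trans (toℚ-+ (U * d) (r * D)) (cong₂ ℚ._+_ (toℚ-* U d) (toℚ-* r D)))) ⟩
  (toℚ U ℚ.* toℚ d ℚ.+ toℚ r ℚ.* toℚ D) ℚ.* toℚ e
    ≡⟨ cong (λ x → (toℚ U ℚ.* toℚ d ℚ.+ x ℚ.* toℚ D) ℚ.* toℚ e) ρd≡r ⟨
  (toℚ U ℚ.* toℚ d ℚ.+ (ρ ℚ.* toℚ d) ℚ.* toℚ D) ℚ.* toℚ e
    ≡⟨ solve 5 (λ u ρ δ d e → (u :* d :+ (ρ :* d) :* δ) :* e := (u :+ ρ :* δ) :* (d :* e))
             refl (toℚ U) ρ (toℚ D) (toℚ d) (toℚ e) ⟩
  (toℚ U ℚ.+ ρ ℚ.* toℚ D) ℚ.* (toℚ d ℚ.* toℚ e)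
    ≤⟨ ℚ.*-monoʳ-≤-nonNeg (toℚ d ℚ.* toℚ e) {{de≥0}} weight≤ ⟩
  (1ℚ ℚ.+ ε) ℚ.* toℚ C ℚ.* (toℚ d ℚ.* toℚ e)
    ≡⟨ solve 4 (λ ε c d e → (con 1ℚ :+ ε) :* c :* (d :* e) := (e :+ ε :* e) :* c :* d)
             refl ε (toℚ C) (toℚ d) (toℚ e) ⟩
  (toℚ e ℚ.+ ε ℚ.* toℚ e) ℚ.* toℚ C ℚ.* toℚ d
    ≡⟨ cong (λ x → (toℚ e ℚ.+ x) ℚ.* toℚ C ℚ.* toℚ d) εe≡p ⟩
  (toℚ e ℚ.+ toℚ p) ℚ.* toℚ C ℚ.* toℚ d
    ≡⟨ trans (toℚ-* ((e + p) * C) d)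
             (cong (ℚ._* toℚ d) (trans (toℚ-* (e + p) C) (cong (ℚ._* toℚ C) (toℚ-+ e p)))) ⟨
  toℚ ((e + p) * C * d) ∎)
  where
  open ℚ.≤-Reasoning
  open +-*-Solver
  de≥0 : NonNegative (toℚ d ℚ.* toℚ e)
  de≥0 = ℚ.nonNeg*nonNeg⇒nonNeg (toℚ d) {{toℚ-nonNegative d}} (toℚ e) {{toℚ-nonNegative e}}

weight-one-≤ : ∀ {ε} U D C → U + D ≤ C → 0ℚ ℚ.≤ ε → toℚ U ℚ.+ 1ℚ ℚ.* toℚ D ℚ.≤ (1ℚ ℚ.+ ε) ℚ.* toℚ C
weight-one-≤ {ε} U D C U+D≤C ε≥0 = begin
  toℚ U ℚ.+ 1ℚ ℚ.* toℚ D   ≡⟨ cong (toℚ U ℚ.+_) (ℚ.*-identityˡ (toℚ D)) ⟩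
  toℚ U ℚ.+ toℚ D          ≡⟨ toℚ-+ U D ⟨
  toℚ (U + D)              ≤⟨ toℚ-mono-≤ U+D≤C ⟩
  toℚ C                    ≡⟨ ℚ.*-identityˡ (toℚ C) ⟨
  1ℚ ℚ.* toℚ C             ≤⟨ ℚ.*-monoʳ-≤-nonNeg (toℚ C) {{toℚ-nonNegative C}} 1≤1+ε ⟩
  (1ℚ ℚ.+ ε) ℚ.* toℚ C     ∎
  where
  open ℚ.≤-Reasoning
  1≤1+ε : 1ℚ ℚ.≤ 1ℚ ℚ.+ ε
  1≤1+ε = ℚ.≤-trans (ℚ.≤-reflexive (sym (ℚ.+-identityʳ 1ℚ))) (ℚ.+-monoʳ-≤ 1ℚ ε≥0)

-- Multiplying by 2 and adding K, the identities 2 C(k,2) + k = k² for k = m, n reduce the claim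
-- to a polynomial identity whose excess is h ((2 + d) h + d (e + d + 2)) > 0.
split-weight-gap : ∀ d k → let h = suc k; m = suc d * h; n = m + h; e = suc d * suc d in
  (e + 1) * (n C 2) * d < ((m C 2) * d + suc d * (m * h)) * e
split-weight-gap d k = *-cancelˡ-< 2 _ _ (+-cancelʳ-< K _ _ (begin-strict
  2 * ((e + 1) * B * d) + K
    ≡⟨ regroupʳ e d n m B ⟩
  (e + 1) * d * (2 * B + n) + d * e * m
    ≡⟨ cong (λ x → (e + 1) * d * x + d * e * m) (2*nC2+n≡n*n n) ⟩
  (e + 1) * d * (n * n) + d * e * m
    <⟨ m<m+n _ (s≤s z≤n) ⟩
  (e + 1) * d * (n * n) + d * e * m + h * ((2 + d) * h + d * (e + d + 2))
    ≡⟨ identity d h ⟩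
  d * e * (m * m) + 2 * suc d * (m * h) * e + (e + 1) * d * n
    ≡⟨ cong (λ x → d * e * x + 2 * suc d * (m * h) * e + (e + 1) * d * n) (2*nC2+n≡n*n m) ⟨
  d * e * (2 * A + m) + 2 * suc d * (m * h) * e + (e + 1) * d * n
    ≡⟨ regroupˡ e d n m A (m * h) ⟩
  2 * ((A * d + suc d * (m * h)) * e) + K ∎))
  where
  open ≤-Reasoning
  h = suc k
  m = suc d * h
  n = m + h
  e = suc d * suc d
  A = m C 2
  B = n C 2
  K = (e + 1) * d * n + d * e * m
  regroupʳ : ∀ e d n m B → 2 * ((e + 1) * B * d) + ((e + 1) * d * n + d * e * m)
                         ≡ (e + 1) * d * (2 * B + n) + d * e * m
  regroupʳ = solve-∀
  regroupˡ : ∀ e d n m A D → d * e * (2 * A + m) + 2 * suc d * D * e + (e + 1) * d * n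
                           ≡ 2 * ((A * d + suc d * D) * e) + ((e + 1) * d * n + d * e * m)
  regroupˡ = solve-∀
  identity : ∀ d h → let m = suc d * h; n = m + h; e = suc d * suc d in
    (e + 1) * d * (n * n) + d * e * m + h * ((2 + d) * h + d * (e + d + 2))
      ≡ d * e * (m * m) + 2 * suc d * (m * h) * e + (e + 1) * d * n
  identity = solve-∀

-- The error term is 1/[1+ d + d * suc d ] = 1/(d+1)².
split-counts-too-heavy : ∀ {ρ} r d N → d < r → ρ ℚ.* toℚ d ≡ toℚ r →
  let h = suc N; m = suc d * h in
  (G : MixedGraph (m + h)) → undEdges G ≡ m C 2 → dirEdges G ≡ m * h →
  ¬ WeightAtMost ρ G (1ℚ ℚ.+ 1/[1+ d + d * suc d ])
split-counts-too-heavy {ρ} r d N d<r ρd≡r G #und #dir weight≤ = <⇒≱ (split-weight-gap d N) (begin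
  (A * d + suc d * D) * e                ≤⟨ *-monoˡ-≤ e (+-monoʳ-≤ (A * d) (*-monoˡ-≤ D d<r)) ⟩
  (A * d + r * D) * e                    ≡⟨ cong₂ (λ U D → (U * d + r * D) * e) #und #dir ⟨
  (undEdges G * d + r * dirEdges G) * e  ≤⟨ clear-denominators {ρ} {1/[1+ d + d * suc d ]}
                                              (undEdges G) (dirEdges G) (n C 2) r d 1 e ρd≡r εe≡1 weight≤ ⟩
  (e + 1) * (n C 2) * d                  ∎)
  where
  open ≤-Reasoning
  e = suc d * suc d
  h = suc N
  m = suc d * h
  n = m + h
  A = m C 2
  D = m * h
  εe≡1 : 1/[1+ d + d * suc d ] ℚ.* toℚ e ≡ toℚ 1
  εe≡1 = fraction-*-denominator 1 (d + d * suc d) ℚᵘ.≃-refl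

admissible-one : ∀ {k} (F : MixedGraph k) → Admissible F 1ℚ
admissible-one F ε ε>0 = 0 , λ n _ _ G _ →
  weight-one-≤ (undEdges G) (dirEdges G) (n C 2) (undEdges+dirEdges≤nC2 G) (ℚ.<⇒≤ ε>0)

inadmissible-above-one : ∀ {k} (F : MixedGraph k) → Uncollapsible F → ∀ ρ → 1ℚ ℚ.< ρ → ¬ Admissible F ρ
inadmissible-above-one F uncollapsible ρ 1<ρ admissible =
  let r , d , d<r , ρd≡r        = 1<p⇒fraction 1<ρ
      N , bounded               = admissible 1/[1+ d + d * suc d ] (1/[1+n]>0 (d + d * suc d))
      h = suc N; m = suc d * h
      G , G-free , #und , #dir  = free-split-graph F uncollapsible m h
      N≤m+h = ≤-trans (n≤1+n N) (m≤n+m h m)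
      2≤m+h = +-mono-≤ {1} {m} {1} {h} (s≤s z≤n) (s≤s z≤n)
  in  split-counts-too-heavy {ρ} r d N d<r ρd≡r G #und #dir (bounded (m + h) N≤m+h 2≤m+h G G-free)

corollary3p4 : ∀ {k : ℕ} (F : MixedGraph k) → Uncollapsible F → ThetaIsOne F
corollary3p4 F uncollapsible = admissible-one F , inadmissible-above-one F uncollapsible
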